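{- If $G$ is a double-critical $8$-chromatic graph with minimum degree $10$ and $x$ is a vertex of $G$ with $\deg_G(x)=10$, then the maximum degree of the complement $\overline{G_x}$ of the neighbourhood graph $G_x=G[N(x)]$ satisfies $\Delta(\overline{G_x})\le 3$.
   Context: All graphs are finite, simple and undirected. A connected $k$-chromatic graph $G$ is double-critical if for every edge $uv$ of $G$ the graph $G-u-v$ is $(k-2)$-colourable. $\overline{H}$ denotes the complement of $H$ and $\Delta$ the maximum degree. -}

module Defs where

open import Level using (0ℓ)
open import Data.Nat using (ℕ; zero; suc; _+_; _≤_; _∸_)
open import Data.Fin using (Fin)
open import Data.Product using (Σ; ∃; _×_; _,_)
open import Data.List using (List; []; _∷_)
open import Data.Empty using (⊥)
open import Relation.Nullary using (¬_; Dec; yes; no)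
open import Relation.Binary.PropositionalEquality using (_≡_; _≢_)

record Graph (n : ℕ) : Set₁ where
  field
    Adj    : Fin n → Fin n → Set
    adj?   : (u v : Fin n) → Dec (Adj u v)
    irrefl : (u : Fin n) → ¬ Adj u u
    sym    : (u v : Fin n) → Adj u v → Adj v u
open Graph public

count : {n : ℕ} {P : Fin n → Set} → ((i : Fin n) → Dec (P i)) → ℕ
count {zero} d = 0
count {suc n} d with d Fin.zero
... | yes _ = suc (count (λ i → d (Fin.suc i)))
... | no  _ = count (λ i → d (Fin.suc i))

deg : {n : ℕ} (G : Graph n) → Fin n → ℕ
deg G v = count (adj? G v)

MinDegAtLeast : {n : ℕ} → Graph n → ℕ → Set
MinDegAtLeast G d = ∀ v → d ≤ deg G v

Colourable : {n : ℕ} → Graph n → ℕ → Set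
Colourable {n} G k = Σ (Fin n → Fin k) λ c → ∀ u v → Adj G u v → c u ≢ c v

Chromatic : {n : ℕ} → Graph n → ℕ → Set
Chromatic G k = Colourable G k × ¬ Colourable G (k ∸ 1)

data Walk {n : ℕ} (G : Graph n) : Fin n → Fin n → Set where
  here : ∀ {u} → Walk G u u
  step : ∀ {u v w} → Adj G u v → Walk G v w → Walk G u w

Connected : {n : ℕ} → Graph n → Set
Connected G = ∀ u v → Walk G u v

-- G - u - v is j-colourable: a proper j-colouring of the vertices other than u and v
ColourableMinus2 : {n : ℕ} → Graph n → Fin n → Fin n → ℕ → Set
ColourableMinus2 {n} G u v j =
  Σ ((w : Fin n) → w ≢ u → w ≢ v → Fin j) λ c →
    ∀ a b (au : a ≢ u) (av : a ≢ v) (bu : b ≢ u) (bv : b ≢ v) →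
      Adj G a b → c a au av ≢ c b bu bv

DoubleCritical : {n : ℕ} → Graph n → ℕ → Set
DoubleCritical G k =
  Connected G × Chromatic G k × (∀ u v → Adj G u v → ColourableMinus2 G u v (k ∸ 2))

NonAdjInNbhd : {n : ℕ} (G : Graph n) (x y z : Fin n) → Set
NonAdjInNbhd G x y z = Adj G x z × z ≢ y × ¬ Adj G y z

MaxDegComplNbhdAtMost : {n : ℕ} → Graph n → Fin n → ℕ → Set
MaxDegComplNbhdAtMost {n} G x d =
  ∀ y → Adj G x y →
    (dec : (z : Fin n) → Dec (NonAdjInNbhd G x y z)) → count dec ≤ d

module Submission where

-- Let x have degree 10 and let y be a neighbour of x.  By double
-- criticality G - x - y has a proper 6-colouring c, while G itself is not
-- 7-colourable.  Every colour i of c must occur on a common neighbour of x and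
-- y: otherwise put x together with the vertices of colour i adjacent to y into
-- a new class, give y colour i, and obtain a proper 7-colouring of G.  Hence
-- x and y have at least 6 common neighbours, and N(x) contains y, these
-- common neighbours, and the non-neighbours of y in N(x) as disjoint sets, so
-- y has at most 10 - 1 - 6 = 3 non-neighbours in N(x).

open import Defs
open import Data.Nat using (ℕ; zero; suc; _+_; _≤_; z≤n; s≤s; _≤?_)
open import Data.Nat.Properties
  using (≰⇒>; ≤-trans; ≤-reflexive; +-suc; +-monoˡ-≤; +-monoʳ-≤; m≤n⇒m≤1+n; +-cancelʳ-≤;
         module ≤-Reasoning)
open import Data.Fin using (Fin)
open import Data.Fin.Properties using (_≟_; any?; pigeonhole; suc-injective; <⇒≢; 0≢1+n)
open import Data.Product using (Σ; ∃; _×_; _,_; proj₁; proj₂)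
open import Data.Sum using (_⊎_; inj₁; inj₂)
open import Data.Empty using (⊥; ⊥-elim)
open import Function using (_∘_)
open import Relation.Nullary using (¬_; Dec; yes; no)
open import Relation.Nullary.Decidable using (recompute; ¬?; _×-dec_; _⊎-dec_)
open import Relation.Binary.PropositionalEquality
  using (_≡_; _≢_; refl; trans; cong) renaming (sym to ≡-sym)

private
  variable
    n : ℕ

tail : {P : Fin (suc n) → Set} → ((i : Fin (suc n)) → Dec (P i)) → (i : Fin n) → Dec (P (Fin.suc i))
tail d i = d (Fin.suc i)

rank : {P : Fin n → Set} (d : (i : Fin n) → Dec (P i)) (z : Fin n) → P z → Fin (count d)
rank {suc n} d z p with d Fin.zero
rank {suc n} d Fin.zero      p | yes _  = Fin.zero
rank {suc n} d (Fin.suc z)   p | yes _  = Fin.suc (rank (tail d) z p)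
rank {suc n} d Fin.zero      p | no ¬p₀ = ⊥-elim (¬p₀ p)
rank {suc n} d (Fin.suc z)   p | no _   = rank (tail d) z p

rank-injective : {P : Fin n → Set} (d : (i : Fin n) → Dec (P i)) (z w : Fin n) (p : P z) (q : P w) →
                 rank d z p ≡ rank d w q → z ≡ w
rank-injective {suc n} d z w p q e with d Fin.zero
rank-injective {suc n} d Fin.zero    Fin.zero    p q e  | yes _  = refl
rank-injective {suc n} d (Fin.suc z) (Fin.suc w) p q e  | yes _  =
  cong Fin.suc (rank-injective (tail d) z w p q (suc-injective e))
rank-injective {suc n} d (Fin.suc z) (Fin.suc w) p q e  | no _   =
  cong Fin.suc (rank-injective (tail d) z w p q e)
rank-injective {suc n} d Fin.zero    w           p q e  | no ¬p₀ = ⊥-elim (¬p₀ p)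
rank-injective {suc n} d (Fin.suc z) Fin.zero    p q e  | no ¬p₀ = ⊥-elim (¬p₀ q)

-- If m distinct elements satisfy P, then at least m elements satisfy P
-- (otherwise two of their ranks would coincide, by the pigeonhole principle).
count-injection : {m : ℕ} {P : Fin n → Set} (d : (i : Fin n) → Dec (P i)) (f : Fin m → Fin n) →
                  (∀ i → P (f i)) → (∀ i j → f i ≡ f j → i ≡ j) → m ≤ count d
count-injection {m = m} d f Pf f-inj with m ≤? count d
... | yes m≤count = m≤count
... | no  m≰count with pigeonhole (≰⇒> m≰count) (λ i → rank d (f i) (Pf i))
...   | i , j , i<j , same-rank =
  ⊥-elim (<⇒≢ i<j (f-inj i j (rank-injective d (f i) (f j) (Pf i) (Pf j) same-rank)))

count-disjoint : {P Q A : Fin n → Set}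
  (dP : (i : Fin n) → Dec (P i)) (dQ : (i : Fin n) → Dec (Q i)) (dA : (i : Fin n) → Dec (A i)) →
  (∀ z → P z → A z) → (∀ z → Q z → A z) → (∀ z → P z → Q z → ⊥) →
  count dP + count dQ ≤ count dA
count-disjoint {zero} dP dQ dA P⊆A Q⊆A P∩Q=∅ = z≤n
count-disjoint {suc n} dP dQ dA P⊆A Q⊆A P∩Q=∅
  with dP Fin.zero | dQ Fin.zero | dA Fin.zero
     | count-disjoint (tail dP) (tail dQ) (tail dA) (P⊆A ∘ Fin.suc) (Q⊆A ∘ Fin.suc) (P∩Q=∅ ∘ Fin.suc)
... | yes p | yes q | _     | _  = ⊥-elim (P∩Q=∅ Fin.zero p q)
... | yes p | no _  | no ¬a | _  = ⊥-elim (¬a (P⊆A Fin.zero p))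
... | no _  | yes q | no ¬a | _  = ⊥-elim (¬a (Q⊆A Fin.zero q))
... | yes _ | no _  | yes _ | ih = s≤s ih
... | no _  | yes _ | yes _ | ih = ≤-trans (≤-reflexive (+-suc _ _)) (s≤s ih)
... | no _  | no _  | yes _ | ih = m≤n⇒m≤1+n ih
... | no _  | no _  | no _  | ih = ih

adj⇒≢ : (G : Graph n) {u v : Fin n} → Adj G u v → v ≢ u
adj⇒≢ G {u} u~v refl = irrefl G u u~v

CommonNbr : (G : Graph n) → Fin n → Fin n → Fin n → Set
CommonNbr G x y z = Adj G x z × Adj G y z

commonNbr? : (G : Graph n) (x y z : Fin n) → Dec (CommonNbr G x y z)
commonNbr? G x y z = adj? G x z ×-dec adj? G y z

-- The colouring lemma: if G - x - y is properly k-coloured by c and G is not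
-- (k+1)-colourable, every colour of c occurs on a common neighbour of x and y.
-- (The argument works for any two vertices x and y, adjacent or not.)
module CommonNeighbours {k : ℕ} (G : Graph n) (x y : Fin n)
  (c : (w : Fin n) → w ≢ x → w ≢ y → Fin k)
  (proper : ∀ a b (a≢x : a ≢ x) (a≢y : a ≢ y) (b≢x : b ≢ x) (b≢y : b ≢ y) →
            Adj G a b → c a a≢x a≢y ≢ c b b≢x b≢y) where

  -- c with its proof arguments made irrelevant, so that the colour of a
  -- vertex does not depend on how its distinctness from x and y is witnessed.
  colour : (z : Fin n) → .(z ≢ x) → .(z ≢ y) → Fin k
  colour z z≢x z≢y = c z (recompute (¬? (z ≟ x)) z≢x) (recompute (¬? (z ≟ y)) z≢y)

  colour-proper : ∀ u v .(u≢x : u ≢ x) .(u≢y : u ≢ y) .(v≢x : v ≢ x) .(v≢y : v ≢ y) →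
                  Adj G u v → colour u u≢x u≢y ≢ colour v v≢x v≢y
  colour-proper u v _ _ _ _ = proper u v _ _ _ _

  colour-cong : ∀ {u v} .{u≢x : u ≢ x} .{u≢y : u ≢ y} .{v≢x : v ≢ x} .{v≢y : v ≢ y} →
                u ≡ v → colour u u≢x u≢y ≡ colour v v≢x v≢y
  colour-cong refl = refl

  CommonNbrColoured : Fin k → Fin n → Set
  CommonNbrColoured i z =
    Σ (Adj G x z) λ x~z → Σ (Adj G y z) λ y~z → colour z (adj⇒≢ G x~z) (adj⇒≢ G y~z) ≡ i

  commonNbrColoured? : ∀ i z → Dec (CommonNbrColoured i z)
  commonNbrColoured? i z with adj? G x z | adj? G y z
  ... | no ¬x~z | _       = no (¬x~z ∘ proj₁)
  ... | yes _   | no ¬y~z = no (¬y~z ∘ proj₁ ∘ proj₂)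
  ... | yes x~z | yes y~z with colour z (adj⇒≢ G x~z) (adj⇒≢ G y~z) ≟ i
  ...   | yes same = yes (x~z , y~z , same)
  ...   | no  diff = no λ (_ , _ , same) → diff same

  data Role (z : Fin n) : Set where
    isX   : z ≡ x → Role z
    isY   : z ≡ y → Role z
    other : z ≢ x → z ≢ y → Role z

  role : (z : Fin n) → Role z
  role z with z ≟ x | z ≟ y
  ... | yes z≡x | _       = isX z≡x
  ... | no _    | yes z≡y = isY z≡y
  ... | no z≢x  | no z≢y  = other z≢x z≢y

  module Recolouring (i : Fin k) (missing : ∀ z → ¬ CommonNbrColoured i z) where

    -- Colour j becomes suc j, except that colour i on a neighbour of y
    -- (witnessed by the decision) becomes the new colour zero.
    shift : {A : Set} → Fin k → Dec A → Fin (suc k)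
    shift j (yes _) with j ≟ i
    ... | yes _ = Fin.zero
    ... | no _  = Fin.suc j
    shift j (no _) = Fin.suc j

    shift-view : {A : Set} (j : Fin k) (a? : Dec A) →
                 (shift j a? ≡ Fin.zero × j ≡ i × A) ⊎ (shift j a? ≡ Fin.suc j × ¬ (j ≡ i × A))
    shift-view j (yes a) with j ≟ i
    ... | yes j≡i = inj₁ (refl , j≡i , a)
    ... | no  j≢i = inj₂ (refl , j≢i ∘ proj₁)
    shift-view j (no ¬a) = inj₂ (refl , ¬a ∘ proj₂)

    recolour : (z : Fin n) → Role z → Fin (suc k)
    recolour z (isX _)         = Fin.zero
    recolour z (isY _)         = Fin.suc i
    recolour z (other z≢x z≢y) = shift (colour z z≢x z≢y) (adj? G y z)

    zero≢suc : ∀ {s t : Fin (suc k)} {j : Fin k} → s ≡ Fin.zero → t ≡ Fin.suc j → s ≢ t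
    zero≢suc s≡0 t≡1+j s≡t = 0≢1+n (trans (≡-sym s≡0) (trans s≡t t≡1+j))

    x-vs-other : ∀ v (v≢x : v ≢ x) (v≢y : v ≢ y) → Adj G x v → Fin.zero ≢ recolour v (other v≢x v≢y)
    x-vs-other v v≢x v≢y x~v with shift-view (colour v v≢x v≢y) (adj? G y v)
    ... | inj₁ (_ , coloured-i , y~v) = λ _ → missing v (x~v , y~v , coloured-i)
    ... | inj₂ (shifted , _)          = zero≢suc refl shifted

    y-vs-other : ∀ v (v≢x : v ≢ x) (v≢y : v ≢ y) → Adj G y v → Fin.suc i ≢ recolour v (other v≢x v≢y)
    y-vs-other v v≢x v≢y y~v with shift-view (colour v v≢x v≢y) (adj? G y v)
    ... | inj₁ (to-zero , _)  = λ same → zero≢suc to-zero refl (≡-sym same)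
    ... | inj₂ (shifted , ¬i) = λ same → ¬i (≡-sym (suc-injective (trans same shifted)) , y~v)

    other-vs-other : ∀ u v (u≢x : u ≢ x) (u≢y : u ≢ y) (v≢x : v ≢ x) (v≢y : v ≢ y) → Adj G u v →
                     recolour u (other u≢x u≢y) ≢ recolour v (other v≢x v≢y)
    other-vs-other u v u≢x u≢y v≢x v≢y u~v
      with shift-view (colour u u≢x u≢y) (adj? G y u) | shift-view (colour v v≢x v≢y) (adj? G y v)
    ... | inj₁ (_ , u-i , _) | inj₁ (_ , v-i , _) =
      λ _ → colour-proper u v u≢x u≢y v≢x v≢y u~v (trans u-i (≡-sym v-i))
    ... | inj₁ (to-zero , _) | inj₂ (shifted , _) = zero≢suc to-zero shifted
    ... | inj₂ (shifted , _) | inj₁ (to-zero , _) = zero≢suc to-zero shifted ∘ ≡-sym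
    ... | inj₂ (shiftedᵤ , _) | inj₂ (shiftedᵥ , _) =
      λ same → colour-proper u v u≢x u≢y v≢x v≢y u~v
                 (suc-injective (trans (≡-sym shiftedᵤ) (trans same shiftedᵥ)))

    recolour-proper : ∀ u v (ru : Role u) (rv : Role v) → Adj G u v → recolour u ru ≢ recolour v rv
    recolour-proper u v (isX refl) (isX refl) u~v = λ _ → irrefl G u u~v
    recolour-proper u v (isX _) (isY _) u~v = λ ()
    recolour-proper u v (isX refl) (other v≢x v≢y) u~v = x-vs-other v v≢x v≢y u~v
    recolour-proper u v (isY _) (isX _) u~v = λ ()
    recolour-proper u v (isY refl) (isY refl) u~v = λ _ → irrefl G u u~v
    recolour-proper u v (isY refl) (other v≢x v≢y) u~v = y-vs-other v v≢x v≢y u~v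
    recolour-proper u v (other u≢x u≢y) (isX refl) u~v = x-vs-other u u≢x u≢y (sym G u v u~v) ∘ ≡-sym
    recolour-proper u v (other u≢x u≢y) (isY refl) u~v = y-vs-other u u≢x u≢y (sym G u v u~v) ∘ ≡-sym
    recolour-proper u v (other u≢x u≢y) (other v≢x v≢y) u~v = other-vs-other u v u≢x u≢y v≢x v≢y u~v

    recolouring : Colourable G (suc k)
    recolouring = (λ z → recolour z (role z)) , (λ u v → recolour-proper u v (role u) (role v))

  everyColourMeetsCommonNbhd : ¬ Colourable G (suc k) → ∀ i → ∃ (CommonNbrColoured i)
  everyColourMeetsCommonNbhd not-k+1 i with any? (commonNbrColoured? i)
  ... | yes found  = found
  ... | no ¬found = ⊥-elim (not-k+1 (Recolouring.recolouring i (λ z w → ¬found (z , w))))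

  commonNbhd-large : ¬ Colourable G (suc k) → k ≤ count (commonNbr? G x y)
  commonNbhd-large not-k+1 = count-injection (commonNbr? G x y) representative
    (λ i → let (_ , x~z , y~z , _) = everyColourMeetsCommonNbhd not-k+1 i in x~z , y~z)
    representative-injective
    where
    representative : Fin k → Fin n
    representative i = proj₁ (everyColourMeetsCommonNbhd not-k+1 i)

    representative-injective : ∀ i j → representative i ≡ representative j → i ≡ j
    representative-injective i j same
      with everyColourMeetsCommonNbhd not-k+1 i | everyColourMeetsCommonNbhd not-k+1 j
    ... | (_ , x~zᵢ , y~zᵢ , coloured-i) | (_ , x~zⱼ , y~zⱼ , coloured-j) =
      trans (≡-sym coloured-i)
        (trans (colour-cong {u≢x = adj⇒≢ G x~zᵢ} {adj⇒≢ G y~zᵢ} {adj⇒≢ G x~zⱼ} {adj⇒≢ G y~zⱼ} same)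
          coloured-j)

nbhd-decomposition : {n : ℕ} (G : Graph n) (x y : Fin n) → Adj G x y →
  (nonAdj? : (z : Fin n) → Dec (NonAdjInNbhd G x y z)) →
  count nonAdj? + suc (count (commonNbr? G x y)) ≤ deg G x
nbhd-decomposition {n} G x y x~y nonAdj? = begin
  count nonAdj? + suc (count common?)        ≤⟨ +-monoʳ-≤ (count nonAdj?) y-and-common ⟩
  count nonAdj? + count yOrCommon?           ≤⟨ count-disjoint nonAdj? yOrCommon? (adj? G x)
                                                  (λ _ → proj₁) yOrCommon⊆Nx nonAdj∩yOrCommon=∅ ⟩
  deg G x                                    ∎
  where
  open ≤-Reasoning
  common? : (z : Fin n) → Dec (CommonNbr G x y z)
  common? = commonNbr? G x y

  isY? : (z : Fin n) → Dec (z ≡ y)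
  isY? z = z ≟ y

  yOrCommon? : (z : Fin n) → Dec (z ≡ y ⊎ CommonNbr G x y z)
  yOrCommon? z = isY? z ⊎-dec common? z

  yOrCommon⊆Nx : ∀ z → z ≡ y ⊎ CommonNbr G x y z → Adj G x z
  yOrCommon⊆Nx z (inj₁ refl)      = x~y
  yOrCommon⊆Nx z (inj₂ (x~z , _)) = x~z

  nonAdj∩yOrCommon=∅ : ∀ z → NonAdjInNbhd G x y z → z ≡ y ⊎ CommonNbr G x y z → ⊥
  nonAdj∩yOrCommon=∅ z (_ , z≢y , _)   (inj₁ z≡y)       = z≢y z≡y
  nonAdj∩yOrCommon=∅ z (_ , _ , ¬y~z)  (inj₂ (_ , y~z)) = ¬y~z y~z

  y-and-common : suc (count common?) ≤ count yOrCommon?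
  y-and-common = begin
    1 + count common?            ≤⟨ +-monoˡ-≤ (count common?) y-counted ⟩
    count isY? + count common?   ≤⟨ count-disjoint isY? common? yOrCommon? (λ _ → inj₁) (λ _ → inj₂)
                                      (λ { z refl (_ , y~y) → irrefl G z y~y }) ⟩
    count yOrCommon?             ∎
    where
    y-counted : 1 ≤ count isY?
    y-counted = count-injection isY? (λ _ → y) (λ _ → refl) (λ { Fin.zero Fin.zero _ → refl })

mainTheorem7 : (n : ℕ) (G : Graph n) → DoubleCritical G 8 → MinDegAtLeast G 10 →
    (x : Fin n) → deg G x ≡ 10 → MaxDegComplNbhdAtMost G x 3
mainTheorem7 n G (_ , (_ , not7Colourable) , criticality) _ x deg≡10 y x~y nonAdj? =
  +-cancelʳ-≤ 7 (count nonAdj?) 3 (begin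
    count nonAdj? + 7                              ≤⟨ +-monoʳ-≤ (count nonAdj?) (s≤s six-common) ⟩
    count nonAdj? + suc (count (commonNbr? G x y)) ≤⟨ nbhd-decomposition G x y x~y nonAdj? ⟩
    deg G x                                        ≡⟨ deg≡10 ⟩
    10                                             ∎)
  where
  open ≤-Reasoning
  six-common : 6 ≤ count (commonNbr? G x y)
  six-common = let (c , proper) = criticality x y x~y in
    CommonNeighbours.commonNbhd-large G x y c proper not7Colourable
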